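{- Let $P=\{p_1,\ldots,p_d\}$ and $Q=\{q_1,\ldots,q_d\}$ be finite partially ordered sets. Then $$\Gamma(\mathcal{C}(P),-\mathcal{C}(Q))=\bigcup_{W\subset[d]}\mathcal{C}'(\Delta_W(P,Q)).$$ In particular, for every $W\subset[d]$, $\Gamma(\mathcal{C}(P),-\mathcal{C}(Q))_W=\mathcal{C}'(\Delta_W(P,Q))$.
   Context: Let $[d]=\{1,\ldots,d\}$ and $\mathbf{e}_i$ the unit coordinate vectors. For a subset $I$ of $P$, $\rho(I)=\sum_{p_i\in I}\mathbf{e}_i$ (similarly for $Q$ with $q_i$). An antichain is a set of pairwise incomparable elements (including $\emptyset$). The chain polytope $\mathcal{C}(P)=\mathrm{conv}\{\rho(A): A \text{ antichain of } P\}$, and $\Gamma(\mathcal{C}(P),-\mathcal{C}(Q))$ is the convex hull of $\mathcal{C}(P)\cup(-\mathcal{C}(Q))$. For $W\subset[d]$ let $\overline W=[d]\setminus W$, $P_W=\{p_i:i\in W\}$ and $Q_{\overline W}=\{q_j:j\in\overline W\}$ the induced subposets, and $\Delta_W(P,Q)=P_W\oplus Q_{\overline W}$ the ordinal sum (order of $P$ on $P_W$, order of $Q$ on $Q_{\overline W}$, and every element of $P_W$ below every element of $Q_{\overline W}$). For $A\subset\Delta_W(P,Q)$, $\rho'(A)=\sum_{p_i\in A}\mathbf{e}_i-\sum_{q_j\in A}\mathbf{e}_j$, and $\mathcal{C}'(\Delta_W(P,Q))=\mathrm{conv}\{\rho'(A): A \text{ antichain of }\Delta_W(P,Q)\}$.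 For a polytope $\mathcal{P}\subset\mathbb{R}^d$, $\mathcal{P}_W=\{(x_1,\ldots,x_d)\in\mathcal{P}: x_i\ge0 \text{ for } i\in W,\ x_j\le 0\text{ for } j\in\overline W\}$.
   Formalization: Points are taken in ℚ^d instead of ℝ^d, and the convex hulls defining the chain polytopes, Γ and 𝒞′ use rational convex coefficients. -}

module Defs where

open import Data.Nat using (ℕ; zero; suc)
open import Data.Fin using (Fin; zero; suc)
open import Data.Bool using (Bool; true; false; if_then_else_)
open import Data.Rational using (ℚ; 0ℚ; 1ℚ; _+_; _*_; -_; _≤_)
open import Data.Product using (Σ; ∃; _×_; _,_)
open import Data.Sum using (_⊎_; inj₁; inj₂)
open import Data.Empty using (⊥)
open import Data.Unit using (⊤)
open import Relation.Binary using (Rel; IsPartialOrder)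
open import Level using (0ℓ)
open import Relation.Binary.PropositionalEquality using (_≡_)

Point : ℕ → Set
Point d = Fin d → ℚ

PSet : ℕ → Set₁
PSet d = Point d → Set

sumF : {n : ℕ} → (Fin n → ℚ) → ℚ
sumF {zero}  f = 0ℚ
sumF {suc n} f = f zero + sumF (λ k → f (suc k))

conv : {d : ℕ} → PSet d → PSet d
conv {d} S x =
  Σ ℕ λ n → Σ (Fin n → ℚ) λ c → Σ (Fin n → Point d) λ v →
    (∀ k → 0ℚ ≤ c k) × (∀ k → S (v k)) × (sumF c ≡ 1ℚ) ×
    (∀ i → x i ≡ sumF (λ k → c k * v k i))

-- Γ(𝒫, -𝒬) = conv (𝒫 ∪ (-𝒬))
Γ : {d : ℕ} → PSet d → PSet d → PSet d
Γ 𝒫 𝒬 x = conv (λ y → 𝒫 y ⊎ 𝒬 (λ i → - y i)) x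

Antichain : {X : Set} → Rel X 0ℓ → (X → Bool) → Set
Antichain {X} R A = ∀ (x y : X) → A x ≡ true → A y ≡ true → R x y → x ≡ y

IsPoset : {d : ℕ} → Rel (Fin d) 0ℓ → Set
IsPoset R = IsPartialOrder _≡_ R

ρ : {d : ℕ} → (Fin d → Bool) → Point d
ρ A i = if A i then 1ℚ else 0ℚ

𝒞 : {d : ℕ} → Rel (Fin d) 0ℓ → PSet d
𝒞 R = conv (λ x → Σ (Fin _ → Bool) λ A → Antichain R A × (x ≡ ρ A))

Sub : {d : ℕ} → (Fin d → Bool) → Bool → Set
Sub {d} W b = Σ (Fin d) λ i → W i ≡ b

induced : {d : ℕ} → (W : Fin d → Bool) → (b : Bool) → Rel (Fin d) 0ℓ → Rel (Sub W b) 0ℓ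
induced W b R (i , _) (j , _) = R i j

_⊕_ : {X Y : Set} → Rel X 0ℓ → Rel Y 0ℓ → Rel (X ⊎ Y) 0ℓ
(R ⊕ S) (inj₁ x) (inj₁ y) = R x y
(R ⊕ S) (inj₁ x) (inj₂ y) = ⊤
(R ⊕ S) (inj₂ x) (inj₁ y) = ⊥
(R ⊕ S) (inj₂ x) (inj₂ y) = S x y

-- elements of Δ_W(P,Q) = P_W ⊕ Q_{W̄}: p_i (i ∈ W) and q_j (j ∉ W)
ΔElem : {d : ℕ} → (Fin d → Bool) → Set
ΔElem W = Sub W true ⊎ Sub W false

Δ : {d : ℕ} → (W : Fin d → Bool) → Rel (Fin d) 0ℓ → Rel (Fin d) 0ℓ → Rel (ΔElem W) 0ℓ
Δ W P Q = induced W true P ⊕ induced W false Q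

ρ'coord : {d : ℕ} → (W : Fin d → Bool) → (ΔElem W → Bool) → (i : Fin d) → (b : Bool) → W i ≡ b → ℚ
ρ'coord W A i true  e = if A (inj₁ (i , e)) then 1ℚ else 0ℚ
ρ'coord W A i false e = if A (inj₂ (i , e)) then - 1ℚ else 0ℚ

ρ' : {d : ℕ} → (W : Fin d → Bool) → (ΔElem W → Bool) → Point d
ρ' W A i = ρ'coord W A i (W i) _≡_.refl

𝒞' : {d : ℕ} → (W : Fin d → Bool) → Rel (Fin d) 0ℓ → Rel (Fin d) 0ℓ → PSet d
𝒞' W P Q = conv (λ x → Σ (ΔElem W → Bool) λ A → Antichain (Δ W P Q) A × (x ≡ ρ' W A))

restrict : {d : ℕ} → PSet d → (Fin d → Bool) → PSet d
restrict 𝒫 W x = 𝒫 x × (∀ i → (W i ≡ true → 0ℚ ≤ x i) × (W i ≡ false → x i ≤ 0ℚ))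

{-# OPTIONS --safe #-}
-- An antichain of the ordinal sum Δ_W(P,Q) = P_W ⊕ Q_W̄ lies in one summand, so 𝒞'(Δ_W(P,Q)) is the
-- convex hull of the vertices of 𝒞(P_W) and of -𝒞(Q_W̄). These are vertices of Γ with sign pattern W,
-- whence 𝒞'(Δ_W(P,Q)) ⊆ Γ_W. Conversely, write x ∈ Γ_W as x = y + z with y in the cone over 𝒞(P) and
-- z in the cone over -𝒞(Q). Keeping the W-coordinates of y and the W̄-coordinates of z gives a point u
-- of the cone over those vertices, and coordinatewise x = a u with a ∈ [0,1]^d. That cone is closed
-- under such shrinking because subsets of antichains are antichains, so x ∈ 𝒞'(Δ_W(P,Q)).
-- Every x ∈ Γ lies in Γ_W for W its sign pattern.
module Submission where

open import Defs
open import Data.Bool using (Bool; true; false; if_then_else_; _∧_; not)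
open import Data.Bool.Properties using (∧-conicalˡ; ∧-conicalʳ; ¬-not) renaming (_≟_ to _≟ᵇ_)
open import Data.Empty using (⊥; ⊥-elim)
open import Data.Fin using (Fin; zero; suc; _≟_)
open import Data.Fin.Properties using (any?)
open import Data.List using (List; []; _∷_; allFin)
open import Data.List.Membership.Propositional using (_∈_)
open import Data.List.Membership.Propositional.Properties using (∈-allFin)
open import Data.List.Relation.Unary.Any using (here; there)
open import Data.Nat using (ℕ; zero; suc)
open import Data.Product using (Σ; _×_; _,_; proj₁; proj₂)
open import Data.Rational using (ℚ; 0ℚ; 1ℚ; _+_; _*_; -_; _-_; _≤_; _≤?_; 1/_; NonZero; Positive; positive; nonNegative)
open import Data.Rational.Properties hiding (_≟_)
open import Data.Rational.Solver using (module +-*-Solver)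
open import Data.Sum using (_⊎_; inj₁; inj₂)
open import Data.Unit using (tt)
open import Function using (_∘_)
open import Level using (0ℓ)
open import Relation.Binary using (Rel)
open import Relation.Binary.PropositionalEquality
open import Relation.Binary.PropositionalEquality.WithK using (≡-irrelevant)
open import Relation.Nullary using (Dec; yes; no; does)

open +-*-Solver using (solve; _:=_; con; _:+_; _:*_; :-_; _:-_)
open import Algebra.Properties.Group +-0-group using () renaming (⁻¹-involutive to neg-involutive)

private
  variable
    d : ℕ
    a b p q r s t : ℚ
    u v x y : Point d
    S T : PSet d

0≤1 : 0ℚ ≤ 1ℚ
0≤1 = nonNegative⁻¹ 1ℚ

*-nonNeg : 0ℚ ≤ p → 0ℚ ≤ q → 0ℚ ≤ p * q
*-nonNeg {p} {q} 0≤p 0≤q =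
  nonNegative⁻¹ (p * q) {{nonNeg*nonNeg⇒nonNeg p {{nonNegative 0≤p}} q {{nonNegative 0≤q}}}}

*-nonNeg-nonPos : 0ℚ ≤ p → q ≤ 0ℚ → p * q ≤ 0ℚ
*-nonNeg-nonPos {p} 0≤p q≤0 = subst (p * _ ≤_) (*-zeroʳ p) (*-monoˡ-≤-nonNeg p {{nonNegative 0≤p}} q≤0)

UnitInterval : ℚ → Set
UnitInterval a = 0ℚ ≤ a × a ≤ 1ℚ

FractionOf : ℚ → ℚ → Set
FractionOf p q = Σ ℚ λ a → UnitInterval a × p ≡ a * q

fractionOf-nonNeg : 0ℚ ≤ p → p ≤ q → FractionOf p q
fractionOf-nonNeg {p} {q} 0≤p p≤q with q ≤? 0ℚ
... | yes q≤0 = 0ℚ , (≤-refl , 0≤1) , trans (≤-antisym (≤-trans p≤q q≤0) 0≤p) (sym (*-zeroˡ q))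
... | no q≰0 = p * q⁻¹ , (*-nonNeg 0≤p (<⇒≤ (positive⁻¹ q⁻¹)) , a≤1) , p≡a*q
  where
  instance
    q-pos : Positive q
    q-pos = positive (≰⇒> q≰0)
    q-nonZero : NonZero q
    q-nonZero = pos⇒nonZero q
  q⁻¹ : ℚ
  q⁻¹ = 1/ q
  instance
    q⁻¹-pos : Positive q⁻¹
    q⁻¹-pos = 1/pos⇒pos q
  a≤1 : p * q⁻¹ ≤ 1ℚ
  a≤1 = subst (p * q⁻¹ ≤_) (*-inverseʳ q) (*-monoʳ-≤-nonNeg q⁻¹ {{pos⇒nonNeg q⁻¹}} p≤q)
  p≡a*q : p ≡ p * q⁻¹ * q
  p≡a*q = sym (begin
    p * q⁻¹ * q   ≡⟨ *-assoc p q⁻¹ q ⟩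
    p * (q⁻¹ * q) ≡⟨ cong (p *_) (*-inverseˡ q) ⟩
    p * 1ℚ        ≡⟨ *-identityʳ p ⟩
    p             ∎)
    where open ≡-Reasoning

neg-nonNeg⇒nonPos : 0ℚ ≤ - p → p ≤ 0ℚ
neg-nonNeg⇒nonPos {p} 0≤-p = subst (_≤ 0ℚ) (neg-involutive p) (neg-antimono-≤ 0≤-p)

fractionOf-nonPos : q ≤ p → p ≤ 0ℚ → FractionOf p q
fractionOf-nonPos {q} q≤p p≤0 with fractionOf-nonNeg (neg-antimono-≤ p≤0) (neg-antimono-≤ q≤p)
... | a , a∈I , -p≡a*-q = a , a∈I , neg-injective (trans -p≡a*-q (sym (neg-distribʳ-* a q)))

fractionOf-sameSignPart : (c : Bool) → r ≡ p + q → 0ℚ ≤ p → q ≤ 0ℚ →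
  (c ≡ true → 0ℚ ≤ r) → (c ≡ false → r ≤ 0ℚ) → FractionOf r (if c then p else q)
fractionOf-sameSignPart {r = r} {p} {q} true r≡p+q 0≤p q≤0 0≤r _ =
  fractionOf-nonNeg (0≤r refl) (subst (_≤ p) (sym r≡p+q) p+q≤p)
  where
  p+q≤p : p + q ≤ p
  p+q≤p = subst (p + q ≤_) (+-identityʳ p) (+-monoʳ-≤ p q≤0)
fractionOf-sameSignPart {r = r} {p} {q} false r≡p+q 0≤p q≤0 _ r≤0 =
  fractionOf-nonPos (subst (q ≤_) (sym r≡p+q) q≤p+q) (r≤0 refl)
  where
  q≤p+q : q ≤ p + q
  q≤p+q = subst (_≤ p + q) (+-identityˡ q) (+-monoˡ-≤ q 0≤p)

infixl 7 _⊙_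

_⊙_ : Point d → Point d → Point d
(u ⊙ v) i = u i * v i

_∧′_ : {X : Set} → (X → Bool) → (X → Bool) → X → Bool
(A ∧′ B) x = A x ∧ B x

ρ-∧ : (A B : Fin d → Bool) → ρ A ⊙ ρ B ≗ ρ (A ∧′ B)
ρ-∧ A B i with A i | B i
... | true  | true  = refl
... | true  | false = refl
... | false | true  = refl
... | false | false = refl

ρ-nonNeg : (A : Fin d → Bool) (i : Fin d) → 0ℚ ≤ ρ A i
ρ-nonNeg A i with A i
... | true  = 0≤1
... | false = ≤-refl

-- Conic S s x: x is a nonnegative combination of points of S of total weight s. Points are
-- compared pointwise, as there is no function extensionality.
data Conic (S : PSet d) : ℚ → Point d → Set where
  nil  : (∀ i → x i ≡ 0ℚ) → Conic S 0ℚ x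
  cons : ∀ c v → 0ℚ ≤ c → S v → Conic S s y → (∀ i → x i ≡ c * v i + y i) → Conic S (c + s) x

Conic-resp : x ≗ y → Conic S s y → Conic S s x
Conic-resp x≗y (nil y≗0)                = nil (λ i → trans (x≗y i) (y≗0 i))
Conic-resp x≗y (cons c v 0≤c Sv cz y≡) = cons c v 0≤c Sv cz (λ i → trans (x≗y i) (y≡ i))

Conic-map : (∀ {v} → S v → Σ (Point d) λ w → T w × v ≗ w) → Conic S s x → Conic T s x
Conic-map f (nil x≗0) = nil x≗0
Conic-map f (cons c v 0≤c Sv cy x≡) with f Sv
... | w , Tw , v≗w = cons c w 0≤c Tw (Conic-map f cy) (λ i → trans (x≡ i) (cong (λ t → c * t + _) (v≗w i)))

Conic-++ : Conic S s x → Conic S t y → Conic S (s + t) (λ i → x i + y i)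
Conic-++ {S = S} {x = x} {t = t} {y = y} (nil x≗0) cy =
  subst (λ w → Conic S w (λ i → x i + y i)) (sym (+-identityˡ t))
    (Conic-resp (λ i → trans (cong (_+ y i) (x≗0 i)) (+-identityˡ (y i))) cy)
Conic-++ {S = S} {x = x} {t = t} {y = y} (cons {s = s} {y = z} c v 0≤c Sv cz x≡) cy =
  subst (λ w → Conic S w (λ i → x i + y i)) (sym (+-assoc c s t))
    (cons c v 0≤c Sv (Conic-++ cz cy) (λ i → trans (cong (_+ y i) (x≡ i)) (+-assoc (c * v i) (z i) (y i))))

Conic-scale : 0ℚ ≤ a → Conic S s x → Conic S (a * s) (λ i → a * x i)
Conic-scale {a = a} {S = S} {x = x} 0≤a (nil x≗0) =
  subst (λ w → Conic S w (λ i → a * x i)) (sym (*-zeroʳ a)) (nil (λ i → trans (cong (a *_) (x≗0 i)) (*-zeroʳ a)))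
Conic-scale {a = a} {S = S} 0≤a (cons {s = s} {y = y} c v 0≤c Sv cy x≡) =
  subst (λ w → Conic S w _) (sym (*-distribˡ-+ a c s))
    (cons (a * c) v (*-nonNeg 0≤a 0≤c) Sv (Conic-scale 0≤a cy)
      (λ i → trans (cong (a *_) (x≡ i)) (distrib a c (v i) (y i))))
  where
  distrib : ∀ a c v y → a * (c * v + y) ≡ a * c * v + a * y
  distrib = solve 4 (λ a c v y → a :* (c :* v :+ y) := a :* c :* v :+ a :* y) refl

Conic-join : Conic (Conic S 1ℚ) s x → Conic S s x
Conic-join (nil x≗0) = nil x≗0
Conic-join {S = S} {x = x} (cons {s = s} c v 0≤c cv cy x≡) =
  subst (λ w → Conic S w x) (cong (_+ s) (*-identityʳ c))
    (Conic-resp x≡ (Conic-++ (Conic-scale 0≤c cv) (Conic-join cy)))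

Conic-⊙ : (m : Point d) → (∀ {v} → S v → T (m ⊙ v)) → Conic S s x → Conic T s (m ⊙ x)
Conic-⊙ m f (nil x≗0) = nil (λ i → trans (cong (m i *_) (x≗0 i)) (*-zeroʳ (m i)))
Conic-⊙ m f (cons {y = y} c v 0≤c Sv cy x≡) =
  cons c (m ⊙ v) 0≤c (f Sv) (Conic-⊙ m f cy) (λ i → trans (cong (m i *_) (x≡ i)) (distrib (m i) c (v i) (y i)))
  where
  distrib : ∀ m c v y → m * (c * v + y) ≡ c * (m * v) + m * y
  distrib = solve 4 (λ m c v y → m :* (c :* v :+ y) := c :* (m :* v) :+ m :* y) refl

Conic-nonNeg : (i : Fin d) → (∀ {v} → S v → 0ℚ ≤ v i) → Conic S s x → 0ℚ ≤ x i
Conic-nonNeg i f (nil x≗0) = ≤-reflexive (sym (x≗0 i))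
Conic-nonNeg i f (cons c v 0≤c Sv cy x≡) =
  subst (0ℚ ≤_) (sym (x≡ i)) (+-mono-≤ (*-nonNeg 0≤c (f Sv)) (Conic-nonNeg i f cy))

Conic-nonPos : (i : Fin d) → (∀ {v} → S v → v i ≤ 0ℚ) → Conic S s x → x i ≤ 0ℚ
Conic-nonPos i f (nil x≗0) = ≤-reflexive (x≗0 i)
Conic-nonPos i f (cons c v 0≤c Sv cy x≡) =
  subst (_≤ 0ℚ) (sym (x≡ i)) (+-mono-≤ (*-nonNeg-nonPos 0≤c (f Sv)) (Conic-nonPos i f cy))

record Split (S T : PSet d) (s : ℚ) (x : Point d) : Set where
  field
    sˡ sʳ  : ℚ
    xˡ xʳ  : Point d
    left   : Conic S sˡ xˡ
    right  : Conic T sʳ xʳ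
    weight : s ≡ sˡ + sʳ
    point  : ∀ i → x i ≡ xˡ i + xʳ i

Conic-⊎ : Conic (λ v → S v ⊎ T v) s x → Split S T s x
Conic-⊎ (nil x≗0) = record
  { sˡ = 0ℚ ; sʳ = 0ℚ ; xˡ = λ _ → 0ℚ ; xʳ = λ _ → 0ℚ
  ; left = nil (λ _ → refl) ; right = nil (λ _ → refl) ; weight = refl ; point = x≗0 }
Conic-⊎ (cons {s = s} c v 0≤c (inj₁ Sv) cy x≡) = let open Split (Conic-⊎ cy) in record
  { sˡ = c + sˡ ; sʳ = sʳ ; xˡ = λ i → c * v i + xˡ i ; xʳ = xʳ
  ; left = cons c v 0≤c Sv left (λ _ → refl) ; right = right
  ; weight = trans (cong (c +_) weight) (sym (+-assoc c sˡ sʳ))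
  ; point = λ i → trans (x≡ i) (trans (cong (c * v i +_) (point i)) (sym (+-assoc (c * v i) (xˡ i) (xʳ i)))) }
Conic-⊎ (cons {s = s} c v 0≤c (inj₂ Tv) cy x≡) = let open Split (Conic-⊎ cy) in record
  { sˡ = sˡ ; sʳ = c + sʳ ; xˡ = xˡ ; xʳ = λ i → c * v i + xʳ i
  ; left = left ; right = cons c v 0≤c Tv right (λ _ → refl)
  ; weight = trans (cong (c +_) weight) (swap c sˡ sʳ)
  ; point = λ i → trans (x≡ i) (trans (cong (c * v i +_) (point i)) (swap (c * v i) (xˡ i) (xʳ i))) }
  where
  swap : ∀ a b c → a + (b + c) ≡ b + (a + c)
  swap = solve 3 (λ a b c → a :+ (b :+ c) := b :+ (a :+ c)) refl

conv⇒Conic : conv S x → Conic S 1ℚ x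
conv⇒Conic {S = S} (n , c , v , 0≤c , Sv , Σc≡1 , x≡) =
  subst (λ w → Conic S w _) Σc≡1 (Conic-resp x≡ (sums n c v 0≤c Sv))
  where
  sums : ∀ n (c : Fin n → ℚ) (v : Fin n → Point _) → (∀ k → 0ℚ ≤ c k) → (∀ k → S (v k)) →
    Conic S (sumF c) (λ i → sumF (λ k → c k * v k i))
  sums zero    c v 0≤c Sv = nil (λ _ → refl)
  sums (suc n) c v 0≤c Sv =
    cons (c zero) (v zero) (0≤c zero) (Sv zero)
      (sums n (c ∘ suc) (v ∘ suc) (0≤c ∘ suc) (Sv ∘ suc)) (λ _ → refl)

Conic⇒conv : Conic S 1ℚ x → conv S x
Conic⇒conv = combination
  where
  combination : Conic S s x →
    Σ ℕ λ n → Σ (Fin n → ℚ) λ c → Σ (Fin n → Point _) λ v →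
      (∀ k → 0ℚ ≤ c k) × (∀ k → S (v k)) × (sumF c ≡ s) × (∀ i → x i ≡ sumF (λ k → c k * v k i))
  combination (nil x≗0) = 0 , (λ ()) , (λ ()) , (λ ()) , (λ ()) , refl , x≗0
  combination (cons c v 0≤c Sv cy x≡) with combination cy
  ... | n , cs , vs , 0≤cs , Svs , Σcs≡s , y≡ =
    suc n , (λ { zero → c ; (suc k) → cs k }) , (λ { zero → v ; (suc k) → vs k }) ,
    (λ { zero → 0≤c ; (suc k) → 0≤cs k }) , (λ { zero → Sv ; (suc k) → Svs k }) ,
    cong (c +_) Σcs≡s , λ i → trans (x≡ i) (cong (c * v i +_) (y≡ i))

conv-∋ : S v → x ≗ v → conv S x
conv-∋ {v = v} Sv x≗v =
  Conic⇒conv (Conic-resp x≗v (cons 1ℚ v 0≤1 Sv (nil (λ _ → refl)) (λ i → sym (trans (+-identityʳ _) (*-identityˡ (v i))))))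

-- Shrinking coordinate j of v by b ∈ [0, 1] gives the combination b · v + (1 - b) · (v with v j zeroed).
module _ (mask-closed : ∀ (B : Fin d → Bool) {v} → S v → S (ρ B ⊙ v)) where

  Conic-shrinkAt : ∀ j → UnitInterval b → Conic S s u →
    Conic S s (λ i → if does (i ≟ j) then b * u i else u i)
  Conic-shrinkAt {b = b} {s = s} {u = u} j (0≤b , b≤1) cu =
    subst (λ w → Conic S w _) (recombine b s)
      (Conic-resp shrunk (Conic-++ (Conic-scale 0≤b cu) (Conic-scale 0≤1-b (Conic-⊙ (ρ others) (mask-closed others) cu))))
    where
    others : Fin _ → Bool
    others i = not (does (i ≟ j))
    0≤1-b : 0ℚ ≤ 1ℚ - b
    0≤1-b = subst (_≤ 1ℚ - b) (+-inverseʳ b) (+-monoˡ-≤ (- b) b≤1)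
    recombine : ∀ b s → b * s + (1ℚ - b) * s ≡ s
    recombine = solve 2 (λ b s → b :* s :+ (con 1ℚ :- b) :* s := s) refl
    shrunk : ∀ i → (if does (i ≟ j) then b * u i else u i) ≡ b * u i + (1ℚ - b) * (ρ others i * u i)
    shrunk i with does (i ≟ j)
    ... | true  = solve 2 (λ b u → b :* u := b :* u :+ (con 1ℚ :- b) :* (con 0ℚ :* u)) refl b (u i)
    ... | false = solve 2 (λ b u → u := b :* u :+ (con 1ℚ :- b) :* (con 1ℚ :* u)) refl b (u i)

  Conic-shrink : (a : Point d) → (∀ i → UnitInterval (a i)) → Conic S s u → Conic S s (a ⊙ u)
  Conic-shrink {s = s} {u = u} a a∈I cu = shrinkAll (allFin _) a a∈I (λ i → inj₂ (∈-allFin i))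
    where
    shrinkAll : (L : List (Fin d)) (a : Point d) → (∀ i → UnitInterval (a i)) → (∀ i → a i ≡ 1ℚ ⊎ i ∈ L) →
      Conic S s (a ⊙ u)
    shrinkAll [] a _ a≡1 = Conic-resp (λ i → one (a≡1 i)) cu
      where
      one : ∀ {i} → a i ≡ 1ℚ ⊎ i ∈ [] → a i * u i ≡ u i
      one {i} (inj₁ ai≡1) = trans (cong (_* u i) ai≡1) (*-identityˡ (u i))
    shrinkAll (j ∷ L) a a∈I covered =
      Conic-resp shrunk (Conic-shrinkAt j (a∈I j) (shrinkAll L a' a'∈I a'-covered))
      where
      a' : Point d
      a' i = if does (i ≟ j) then 1ℚ else a i
      a'∈I : ∀ i → UnitInterval (a' i)
      a'∈I i with does (i ≟ j)
      ... | true  = 0≤1 , ≤-refl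
      ... | false = a∈I i
      a'-covered : ∀ i → a' i ≡ 1ℚ ⊎ i ∈ L
      a'-covered i with i ≟ j | covered i
      ... | yes _  | _               = inj₁ refl
      ... | no  _  | inj₁ ai≡1       = inj₁ ai≡1
      ... | no i≢j | inj₂ (here i≡j) = ⊥-elim (i≢j i≡j)
      ... | no  _  | inj₂ (there i∈L) = inj₂ i∈L
      shrunk : ∀ i → a i * u i ≡ (if does (i ≟ j) then a j * (a' i * u i) else a' i * u i)
      shrunk i with i ≟ j
      ... | yes refl = cong (a i *_) (sym (*-identityˡ (u i)))
      ... | no  _    = refl

infix 4 _⊆_

_⊆_ : {X : Set} → (X → Bool) → (X → Bool) → Set
A ⊆ B = ∀ x → A x ≡ true → B x ≡ true

antichain-⊆ : {X : Set} {R : Rel X 0ℓ} {A B : X → Bool} → Antichain R A → B ⊆ A → Antichain R B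
antichain-⊆ anti B⊆A x y Bx By = anti x y (B⊆A x Bx) (B⊆A y By)

antichain-⊕ : {X Y : Set} {R : Rel X 0ℓ} {R' : Rel Y 0ℓ} {A : X ⊎ Y → Bool} {x : X} {y : Y} →
  Antichain (R ⊕ R') A → A (inj₁ x) ≡ true → A (inj₂ y) ≡ true → ⊥
antichain-⊕ anti Ax Ay with anti _ _ Ax Ay tt
... | ()

ρ-false : (A : Fin d → Bool) {i : Fin d} → A i ≡ false → ρ A i ≡ 0ℚ
ρ-false A Ai≡false = cong (λ c → if c then 1ℚ else 0ℚ) Ai≡false

⊆-false : {X : Set} {A U : X → Bool} {x : X} → A ⊆ U → U x ≡ false → A x ≡ false
⊆-false {A = A} {x = x} A⊆U Ux≡false with A x in Ax
... | false = refl
... | true  with () ← trans (sym (A⊆U x Ax)) Ux≡false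

ChainVertex : Rel (Fin d) 0ℓ → PSet d
ChainVertex R x = Σ (Fin _ → Bool) λ A → Antichain R A × x ≡ ρ A

𝒞-nonNeg : {R : Rel (Fin d) 0ℓ} → 𝒞 R x → ∀ i → 0ℚ ≤ x i
𝒞-nonNeg {R = R} x∈𝒞 i = Conic-nonNeg i (λ { (A , _ , refl) → ρ-nonNeg A i }) (conv⇒Conic {S = ChainVertex R} x∈𝒞)

module ΔSubsets {W : Fin d → Bool} where

  index : ΔElem W → Fin d
  index (inj₁ (i , _)) = i
  index (inj₂ (i , _)) = i

  Sub-≡ : {c : Bool} {i j : Fin d} → i ≡ j → (e : W i ≡ c) (e' : W j ≡ c) → _≡_ {A = Sub W c} (i , e) (j , e')
  Sub-≡ refl e e' = cong (_ ,_) (≡-irrelevant e e')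

  liftP liftQ : (Fin d → Bool) → ΔElem W → Bool
  liftP A (inj₁ (i , _)) = A i
  liftP A (inj₂ _)       = false
  liftQ B (inj₁ _)       = false
  liftQ B (inj₂ (i , _)) = B i

  antichain-liftP : {P Q : Rel (Fin d) 0ℓ} {A : Fin d → Bool} → Antichain P A → Antichain (Δ W P Q) (liftP A)
  antichain-liftP anti (inj₁ (i , e)) (inj₁ (j , e')) Ai Aj Pij = cong inj₁ (Sub-≡ (anti i j Ai Aj Pij) e e')

  antichain-liftQ : {P Q : Rel (Fin d) 0ℓ} {B : Fin d → Bool} → Antichain Q B → Antichain (Δ W P Q) (liftQ B)
  antichain-liftQ anti (inj₂ (i , e)) (inj₂ (j , e')) Bi Bj Qij = cong inj₂ (Sub-≡ (anti i j Bi Bj Qij) e e')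

  ρ'-liftP : {A : Fin d → Bool} → A ⊆ W → ρ' W (liftP A) ≗ ρ A
  ρ'-liftP {A} A⊆W i = at (W i) refl
    where
    at : ∀ c (e : W i ≡ c) → ρ'coord W (liftP A) i c e ≡ ρ A i
    at true  e = refl
    at false e = sym (ρ-false A (⊆-false A⊆W e))

  ρ'-liftQ : {B : Fin d → Bool} → B ⊆ not ∘ W → ρ' W (liftQ B) ≗ (λ i → - ρ B i)
  ρ'-liftQ {B} B⊆W̄ i = at (W i) refl
    where
    at : ∀ c (e : W i ≡ c) → ρ'coord W (liftQ B) i c e ≡ - ρ B i
    at true  e = cong -_ (sym (ρ-false B (⊆-false B⊆W̄ (cong not e))))
    at false e with B i
    ... | true  = refl
    ... | false = refl

  -- partP A and partQ A are the traces of A on P_W and on Q_W̄, defined by matching on the proof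
  -- of W i ≡ c exactly as ρ'coord is, so that the two reduce together.
  partPAt partQAt : (ΔElem W → Bool) → (i : Fin d) → (c : Bool) → W i ≡ c → Bool
  partPAt A i true  e = A (inj₁ (i , e))
  partPAt A i false _ = false
  partQAt A i true  _ = false
  partQAt A i false e = A (inj₂ (i , e))

  partP partQ : (ΔElem W → Bool) → Fin d → Bool
  partP A i = partPAt A i (W i) refl
  partQ A i = partQAt A i (W i) refl

  partP-member : {A : ΔElem W → Bool} {i : Fin d} → partP A i ≡ true → Σ (W i ≡ true) λ e → A (inj₁ (i , e)) ≡ true
  partP-member {A} {i} = at (W i) refl
    where
    at : ∀ c (e : W i ≡ c) → partPAt A i c e ≡ true → Σ (W i ≡ true) λ e → A (inj₁ (i , e)) ≡ true
    at true e A∋i = e , A∋i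

  partQ-member : {A : ΔElem W → Bool} {i : Fin d} → partQ A i ≡ true → Σ (W i ≡ false) λ e → A (inj₂ (i , e)) ≡ true
  partQ-member {A} {i} = at (W i) refl
    where
    at : ∀ c (e : W i ≡ c) → partQAt A i c e ≡ true → Σ (W i ≡ false) λ e → A (inj₂ (i , e)) ≡ true
    at false e A∋i = e , A∋i

  ρ'-parts : (A : ΔElem W → Bool) → ρ' W A ≗ (λ i → ρ (partP A) i - ρ (partQ A) i)
  ρ'-parts A i = at (W i) refl
    where
    at : ∀ c (e : W i ≡ c) →
      ρ'coord W A i c e ≡ (if partPAt A i c e then 1ℚ else 0ℚ) - (if partQAt A i c e then 1ℚ else 0ℚ)
    at true e with A (inj₁ (i , e))
    ... | true  = refl
    ... | false = refl
    at false e with A (inj₂ (i , e))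
    ... | true  = refl
    ... | false = refl

  antichain-partP : {P Q : Rel (Fin d) 0ℓ} {A : ΔElem W → Bool} → Antichain (Δ W P Q) A → Antichain P (partP A)
  antichain-partP anti i j Ai Aj Pij with partP-member Ai | partP-member Aj
  ... | e , A∋i | e' , A∋j = cong index (anti (inj₁ (i , e)) (inj₁ (j , e')) A∋i A∋j Pij)

  antichain-partQ : {P Q : Rel (Fin d) 0ℓ} {A : ΔElem W → Bool} → Antichain (Δ W P Q) A → Antichain Q (partQ A)
  antichain-partQ anti i j Ai Aj Qij with partQ-member Ai | partQ-member Aj
  ... | e , A∋i | e' , A∋j = cong index (anti (inj₂ (i , e)) (inj₂ (j , e')) A∋i A∋j Qij)

  partP-one-sided : {P Q : Rel (Fin d) 0ℓ} {A : ΔElem W → Bool} {i j : Fin d} →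
    Antichain (Δ W P Q) A → partP A i ≡ true → partQ A j ≡ true → ⊥
  partP-one-sided anti Ai Aj = antichain-⊕ anti (proj₂ (partP-member Ai)) (proj₂ (partQ-member Aj))

module _ {d : ℕ} (W : Fin d → Bool) (P Q : Rel (Fin d) 0ℓ) where

  open ΔSubsets {W = W}

  ΔVertex : PSet d
  ΔVertex x = Σ (ΔElem W → Bool) λ A → Antichain (Δ W P Q) A × x ≡ ρ' W A

  -- The vertices of 𝒞 (P_W) ∪ -𝒞 (Q_W̄), written in ℚ^d.
  SignedVertex : PSet d
  SignedVertex v =
    (Σ (Fin d → Bool) λ A → Antichain P A × A ⊆ W × v ≗ ρ A) ⊎
    (Σ (Fin d → Bool) λ B → Antichain Q B × B ⊆ not ∘ W × v ≗ (λ i → - ρ B i))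

  signedVertex⇒ΔVertex : SignedVertex v → Σ (Point d) λ w → ΔVertex w × v ≗ w
  signedVertex⇒ΔVertex (inj₁ (A , anti , A⊆W , v≗)) =
    ρ' W (liftP A) , (liftP A , antichain-liftP anti , refl) , λ i → trans (v≗ i) (sym (ρ'-liftP A⊆W i))
  signedVertex⇒ΔVertex (inj₂ (B , anti , B⊆W̄ , v≗)) =
    ρ' W (liftQ B) , (liftQ B , antichain-liftQ anti , refl) , λ i → trans (v≗ i) (sym (ρ'-liftQ B⊆W̄ i))

  ΔVertex⇒signedVertex : ΔVertex v → SignedVertex v
  ΔVertex⇒signedVertex (A , anti , refl) with any? (λ i → partP A i ≟ᵇ true)
  ... | yes (i , Ai) = inj₁ (partP A , antichain-partP anti , (λ _ → proj₁ ∘ partP-member) , onlyP)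
    where
    onlyP : ρ' W A ≗ ρ (partP A)
    onlyP j = begin
      ρ' W A j                          ≡⟨ ρ'-parts A j ⟩
      ρ (partP A) j - ρ (partQ A) j     ≡⟨ cong (λ t → ρ (partP A) j - t) (ρ-false (partQ A) (¬-not (partP-one-sided anti Ai))) ⟩
      ρ (partP A) j - 0ℚ                ≡⟨ +-identityʳ _ ⟩
      ρ (partP A) j                     ∎
      where open ≡-Reasoning
  ... | no  ∄i = inj₂ (partQ A , antichain-partQ anti , (λ _ → cong not ∘ proj₁ ∘ partQ-member) , onlyQ)
    where
    onlyQ : ρ' W A ≗ (λ j → - ρ (partQ A) j)
    onlyQ j = begin
      ρ' W A j                          ≡⟨ ρ'-parts A j ⟩
      ρ (partP A) j - ρ (partQ A) j     ≡⟨ cong (_- ρ (partQ A) j) (ρ-false (partP A) (¬-not (λ Aj → ∄i (j , Aj)))) ⟩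
      0ℚ - ρ (partQ A) j                ≡⟨ +-identityˡ _ ⟩
      - ρ (partQ A) j                   ∎
      where open ≡-Reasoning

  signedVertex-nonNeg : {i : Fin d} → W i ≡ true → SignedVertex v → 0ℚ ≤ v i
  signedVertex-nonNeg {i = i} _ (inj₁ (A , _ , _ , v≗)) = subst (0ℚ ≤_) (sym (v≗ i)) (ρ-nonNeg A i)
  signedVertex-nonNeg {i = i} Wi (inj₂ (B , _ , B⊆W̄ , v≗)) =
    ≤-reflexive (sym (trans (v≗ i) (cong -_ (ρ-false B (⊆-false B⊆W̄ (cong not Wi))))))

  signedVertex-nonPos : {i : Fin d} → W i ≡ false → SignedVertex v → v i ≤ 0ℚ
  signedVertex-nonPos {i = i} W̄i (inj₁ (A , _ , A⊆W , v≗)) = ≤-reflexive (trans (v≗ i) (ρ-false A (⊆-false A⊆W W̄i)))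
  signedVertex-nonPos {i = i} _ (inj₂ (B , _ , _ , v≗)) = subst (_≤ 0ℚ) (sym (v≗ i)) (neg-antimono-≤ (ρ-nonNeg B i))

  signedVertex-mask : (C : Fin d → Bool) → SignedVertex v → SignedVertex (ρ C ⊙ v)
  signedVertex-mask C (inj₁ (A , anti , A⊆W , v≗)) =
    inj₁ (C ∧′ A , antichain-⊆ anti (λ i → ∧-conicalʳ (C i) (A i)) , (λ i → A⊆W i ∘ ∧-conicalʳ (C i) (A i)) ,
          λ i → trans (cong (ρ C i *_) (v≗ i)) (ρ-∧ C A i))
  signedVertex-mask C (inj₂ (B , anti , B⊆W̄ , v≗)) =
    inj₂ (C ∧′ B , antichain-⊆ anti (λ i → ∧-conicalʳ (C i) (B i)) , (λ i → B⊆W̄ i ∘ ∧-conicalʳ (C i) (B i)) ,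
          λ i → trans (cong (ρ C i *_) (v≗ i)) (trans (sym (neg-distribʳ-* (ρ C i) (ρ B i))) (cong -_ (ρ-∧ C B i))))

  chainVertex-maskP : ChainVertex P v → SignedVertex (ρ W ⊙ v)
  chainVertex-maskP (A , anti , refl) =
    inj₁ (W ∧′ A , antichain-⊆ anti (λ i → ∧-conicalʳ (W i) (A i)) , (λ i → ∧-conicalˡ (W i) (A i)) , ρ-∧ W A)

  chainVertex-maskQ : ChainVertex Q v → SignedVertex ((λ i → - ρ (not ∘ W) i) ⊙ v)
  chainVertex-maskQ (B , anti , refl) =
    inj₂ ((not ∘ W) ∧′ B , antichain-⊆ anti (λ i → ∧-conicalʳ (not (W i)) (B i)) , (λ i → ∧-conicalˡ (not (W i)) (B i)) ,
          λ i → trans (sym (neg-distribˡ-* (ρ (not ∘ W) i) (ρ B i))) (cong -_ (ρ-∧ (not ∘ W) B i)))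

  𝒞-maskP : 𝒞 P y → Conic SignedVertex 1ℚ (ρ W ⊙ y)
  𝒞-maskP y∈𝒞 = Conic-⊙ (ρ W) chainVertex-maskP (conv⇒Conic {S = ChainVertex P} y∈𝒞)

  -𝒞-maskQ : 𝒞 Q (λ i → - y i) → Conic SignedVertex 1ℚ (ρ (not ∘ W) ⊙ y)
  -𝒞-maskQ {y = y} -y∈𝒞 =
    Conic-resp (λ i → neg-squared (ρ (not ∘ W) i) (y i))
      (Conic-⊙ (λ i → - ρ (not ∘ W) i) chainVertex-maskQ (conv⇒Conic {S = ChainVertex Q} -y∈𝒞))
    where
    neg-squared : ∀ a b → a * b ≡ - a * - b
    neg-squared = solve 2 (λ a b → a :* b := (:- a) :* (:- b)) refl

  signedVertex⇒Γvertex : SignedVertex v → Σ (Point d) λ w → (𝒞 P w ⊎ 𝒞 Q (λ i → - w i)) × v ≗ w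
  signedVertex⇒Γvertex (inj₁ (A , anti , _ , v≗)) =
    ρ A , inj₁ (conv-∋ {S = ChainVertex P} (A , anti , refl) (λ _ → refl)) , v≗
  signedVertex⇒Γvertex (inj₂ (B , anti , _ , v≗)) =
    (λ i → - ρ B i) , inj₂ (conv-∋ {S = ChainVertex Q} (B , anti , refl) (λ i → neg-involutive (ρ B i))) , v≗

  𝒞'⇒restrict : 𝒞' W P Q x → restrict (Γ (𝒞 P) (𝒞 Q)) W x
  𝒞'⇒restrict {x = x} x∈𝒞' =
    Conic⇒conv (Conic-map signedVertex⇒Γvertex x∈±) ,
    λ i → (λ Wi → Conic-nonNeg i (signedVertex-nonNeg Wi) x∈±) ,
          (λ W̄i → Conic-nonPos i (signedVertex-nonPos W̄i) x∈±)
    where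
    x∈± : Conic SignedVertex 1ℚ x
    x∈± = Conic-map (λ v∈Δ → _ , ΔVertex⇒signedVertex v∈Δ , λ _ → refl) (conv⇒Conic {S = ΔVertex} x∈𝒞')

  restrict⇒𝒞' : restrict (Γ (𝒞 P) (𝒞 Q)) W x → 𝒞' W P Q x
  restrict⇒𝒞' {x = x} (x∈Γ , x-signs) =
    Conic⇒conv (Conic-map signedVertex⇒ΔVertex
      (Conic-resp (λ i → proj₂ (proj₂ (fraction i)))
        (Conic-shrink (λ C → signedVertex-mask C) factor (proj₁ ∘ proj₂ ∘ fraction) signedPart∈)))
    where
    open Split (Conic-⊎ {S = 𝒞 P} {T = λ y → 𝒞 Q (λ i → - y i)} (conv⇒Conic x∈Γ))
    signedPart : Point d
    signedPart i = if W i then xˡ i else xʳ i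
    select : ∀ c p q → (if c then p else q) ≡ (if c then 1ℚ else 0ℚ) * p + (if not c then 1ℚ else 0ℚ) * q
    select true  = solve 2 (λ p q → p := con 1ℚ :* p :+ con 0ℚ :* q) refl
    select false = solve 2 (λ p q → q := con 0ℚ :* p :+ con 1ℚ :* q) refl
    signedPart∈ : Conic SignedVertex 1ℚ signedPart
    signedPart∈ = subst (λ s → Conic SignedVertex s signedPart) (sym weight)
      (Conic-resp (λ i → select (W i) (xˡ i) (xʳ i))
        (Conic-++ (Conic-join (Conic-⊙ (ρ W) 𝒞-maskP left)) (Conic-join (Conic-⊙ (ρ (not ∘ W)) -𝒞-maskQ right))))
    fraction : ∀ i → FractionOf (x i) (signedPart i)
    fraction i = fractionOf-sameSignPart (W i) (point i)
      (Conic-nonNeg i (λ y∈𝒞 → 𝒞-nonNeg y∈𝒞 i) left)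
      (Conic-nonPos i (λ -y∈𝒞 → neg-nonNeg⇒nonPos (𝒞-nonNeg -y∈𝒞 i)) right)
      (proj₁ (x-signs i)) (proj₂ (x-signs i))
    factor : Point d
    factor = proj₁ ∘ fraction

signPattern : Point d → Fin d → Bool
signPattern x i = does (0ℚ ≤? x i)

signPattern-sound : (x : Point d) (i : Fin d) →
  (signPattern x i ≡ true → 0ℚ ≤ x i) × (signPattern x i ≡ false → x i ≤ 0ℚ)
signPattern-sound x i = sound (0ℚ ≤? x i)
  where
  sound : (D : Dec (0ℚ ≤ x i)) → (does D ≡ true → 0ℚ ≤ x i) × (does D ≡ false → x i ≤ 0ℚ)
  sound (yes 0≤xi) = (λ _ → 0≤xi) , λ ()
  sound (no 0≰xi)  = (λ ()) , λ _ → <⇒≤ (≰⇒> 0≰xi)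

proposition1p2 : (d : ℕ) → (P Q : Rel (Fin d) 0ℓ) → IsPoset P → IsPoset Q →
    ((x : Point d) →
      (Γ (𝒞 P) (𝒞 Q) x → Σ (Fin d → Bool) (λ W → 𝒞' W P Q x)) ×
      (Σ (Fin d → Bool) (λ W → 𝒞' W P Q x) → Γ (𝒞 P) (𝒞 Q) x)) ×
    ((W : Fin d → Bool) → (x : Point d) →
      (restrict (Γ (𝒞 P) (𝒞 Q)) W x → 𝒞' W P Q x) ×
      (𝒞' W P Q x → restrict (Γ (𝒞 P) (𝒞 Q)) W x))
proposition1p2 d P Q _ _ =
  (λ x → (λ x∈Γ → signPattern x , restrict⇒𝒞' (signPattern x) P Q (x∈Γ , signPattern-sound x)) ,
         (λ (W , x∈𝒞') → proj₁ (𝒞'⇒restrict W P Q x∈𝒞'))) ,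
  (λ W x → restrict⇒𝒞' W P Q , 𝒞'⇒restrict W P Q)
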